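{- Let $a,b\in A^*$ with $a$ nonempty, and suppose $ab$ is a Nyldon word. Then for every integer $k\ge 1$, the word $a^kab$ is not a Nyldon word.
   Context: $A=\{0,1,\dots,m\}$ ($m\ge 1$) is a finite alphabet ordered $0<1<\cdots<m$. The lexicographic order $<_{\text{lex}}$ on $A^*$: $u<_{\text{lex}}v$ if $u$ is a proper prefix of $v$, or there are a word $p$ and letters $i<j$ with $pi$ a prefix of $u$ and $pj$ a prefix of $v$. Nyldon words are defined recursively: a nonempty word $w$ is Nyldon if $w$ is a single letter, or $w$ cannot be written as $w=w_1w_2\cdots w_k$ with $k\ge 2$, each $w_i$ Nyldon, and $w_1\le_{\text{lex}}w_2\le_{\text{lex}}\cdots\le_{\text{lex}}w_k$. -}

module Defs where

open import Data.Nat using (ℕ; zero; suc; _≤_)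
open import Data.Fin using (Fin) renaming (_<_ to _<ᶠ_)
open import Data.List using (List; []; _∷_; _++_; length; concat; replicate)
open import Data.List.Relation.Unary.All using (All)
open import Data.List.Relation.Unary.Linked using (Linked)
open import Data.Product using (Σ; ∃; _×_; _,_)
open import Data.Sum using (_⊎_)
open import Data.Empty using (⊥)
open import Relation.Nullary using (¬_)
open import Relation.Binary.PropositionalEquality using (_≡_; _≢_)

-- Alphabet A = {0,1,...,m} is Fin (suc m), ordered by the usual order on Fin.
Word : ℕ → Set
Word m = List (Fin (suc m))

-- Lexicographic order, literally as in the paper:
-- u <lex v iff u is a proper prefix of v, or there are a word p and letters i < j
-- with p i a prefix of u and p j a prefix of v.
_<lex_ : ∀ {m} → Word m → Word m → Set
_<lex_ {m} u v =
  (Σ (Word m) λ s → s ≢ [] × v ≡ u ++ s)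
  ⊎ (Σ (Word m) λ p → Σ (Fin (suc m)) λ i → Σ (Fin (suc m)) λ j →
       Σ (Word m) λ s → Σ (Word m) λ t →
         i <ᶠ j × u ≡ p ++ (i ∷ s) × v ≡ p ++ (j ∷ t))

_≤lex_ : ∀ {m} → Word m → Word m → Set
u ≤lex v = u ≡ v ⊎ u <lex v

-- Nyldon words, following the recursive definition, with a fuel parameter n
-- (any n ≥ length w gives the correct answer, since factors in a factorization
-- into ≥ 2 nonempty words are strictly shorter than w).
NyldonF : ∀ {m} → ℕ → Word m → Set
NyldonF zero w = ⊥
NyldonF {m} (suc n) w =
  length w ≡ 1
  ⊎ (w ≢ [] ×
     ¬ (Σ (List (Word m)) λ fs →
          2 ≤ length fs × concat fs ≡ w × All (NyldonF n) fs × Linked _≤lex_ fs))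

Nyldon : ∀ {m} → Word m → Set
Nyldon w = NyldonF (length w) w

_^_ : ∀ {m} → Word m → ℕ → Word m
a ^ k = concat (replicate k a)

-- Factor a into Nyldon words in nondecreasing order, a = h h₂ ⋯ hᵣ. Then a^k a b = h · u · ab, where
-- u = h₂ ⋯ hᵣ (h h₂ ⋯ hᵣ)^(k-1) is a product of Nyldon words all ≥ h, and ab ≥ h because h is a prefix
-- of ab. Inserting the factors of u one at a time, from the right, into the one-factor factorization (ab)
-- keeps a nondecreasing Nyldon factorization whose first factor is ≥ h: a Nyldon word g goes in front of
-- the first factor t if g ≤ t; otherwise, splitting g = g′g″ at its longest proper Nyldon suffix, g is
-- merged with t into the Nyldon word gt if g″ ≤ t (or g is a letter), and else g″ and then g′ are
-- inserted recursively.
-- Putting h in front then gives a nondecreasing factorization of a^k a b into at least two Nyldon words.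
-- Merging rests on Grinberg's theory of Nyldon words: the last factor of a nondecreasing Nyldon
-- factorization is the longest Nyldon suffix, proper Nyldon suffixes of a Nyldon word are smaller than
-- it, and g′ is a Nyldon word with g″ < g′. Factorizations and longest suffixes are obtained only under
-- double negation, which suffices because every conclusion drawn from them is stable.

module Submission where

open import Defs
open import Data.Nat using (ℕ; zero; suc; _≤_; _<_; z≤n; s≤s)
open import Data.Nat.Properties using (≤-total; ≤-trans; ≤-refl; ≤-pred; ≤-<-trans; ≤⇒≯; m≤m+n; m≤n+m; ≤-antisym)
open import Data.Nat.Induction using (<-wellFounded)
open import Data.Fin using (Fin) renaming (_<_ to _<ᶠ_)
import Data.Fin.Properties as Fin
open import Data.List using (List; []; _∷_; _++_; _∷ʳ_; [_]; length; concat; replicate; map; InitLast; _∷ʳ′_; initLast)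
open import Data.List.Properties using (++-cancelʳ; ++-assoc; ++-identityʳ; length-++; ∷-injective; concat-++; ++-conicalˡ; concat-concat; map-replicate)
open import Data.List.Relation.Unary.All as All using (All; []; _∷_)
import Data.List.Relation.Unary.All.Properties as All
open import Data.List.Relation.Unary.AllPairs as AllPairs using (AllPairs; []; _∷_)
import Data.List.Relation.Unary.AllPairs.Properties as AllPairs
open import Data.List.Relation.Unary.Linked as Linked using (Linked)
open import Data.List.Relation.Unary.Linked.Properties using (AllPairs⇒Linked; Linked⇒AllPairs)
open import Data.List.Relation.Binary.Lex.Strict as Lex using (Lex-<; halt; this; next)
open import Data.List.Relation.Binary.Pointwise as Pointwise using (Pointwise-≡⇒≡)
import Data.Product as Product
open import Data.Product using (∃; ∃₂; _×_; _,_; proj₁; proj₂)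
open import Data.Sum using (_⊎_; inj₁; inj₂)
open import Data.Empty using (⊥; ⊥-elim)
open import Function using (_on_; _∘_; case_of_)
open import Induction.WellFounded using (WellFounded; Acc; acc)
import Relation.Binary.Construct.On as On
open import Relation.Binary using (Rel; tri<; tri≈; tri>)
open import Relation.Nullary using (¬_; Dec; yes; no)
open import Relation.Nullary.Decidable using (decidable-stable)
open import Relation.Nullary.Negation using (Stable; ¬¬-Monad; contradiction)
open import Relation.Nullary.Decidable.Core using (¬¬-excluded-middle)
open import Relation.Binary.PropositionalEquality using (_≡_; _≢_; refl; sym; trans; cong; subst; isEquivalence; resp₂; module ≡-Reasoning)
open import Effect.Monad using (RawMonad)
open import Level using (0ℓ)
open ≡-Reasoning

module _ {A : Set} where

  length-prefix-≤ : ∀ (xs ys : List A) → length xs ≤ length (xs ++ ys)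
  length-prefix-≤ xs ys = subst (length xs ≤_) (sym (length-++ xs)) (m≤m+n _ _)

  length-suffix-≤ : ∀ (xs ys : List A) → length ys ≤ length (xs ++ ys)
  length-suffix-≤ xs ys = subst (length ys ≤_) (sym (length-++ xs)) (m≤n+m _ _)

  length-proper-suffix-< : ∀ {xs} (ys : List A) → xs ≢ [] → length ys < length (xs ++ ys)
  length-proper-suffix-< {[]} _ xs≢[] = ⊥-elim (xs≢[] refl)
  length-proper-suffix-< {x ∷ xs} ys _ = s≤s (length-suffix-≤ xs ys)

  length-proper-prefix-< : ∀ (xs : List A) {ys} → ys ≢ [] → length xs < length (xs ++ ys)
  length-proper-prefix-< [] {[]} ys≢[] = ⊥-elim (ys≢[] refl)
  length-proper-prefix-< [] {y ∷ ys} _ = s≤s z≤n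
  length-proper-prefix-< (x ∷ xs) ys≢[] = s≤s (length-proper-prefix-< xs ys≢[])

  length-pos : ∀ {xs : List A} → xs ≢ [] → 1 ≤ length xs
  length-pos {[]} xs≢[] = ⊥-elim (xs≢[] refl)
  length-pos {_ ∷ _} _ = s≤s z≤n

  2≤length-++ : ∀ {xs ys : List A} → xs ≢ [] → ys ≢ [] → 2 ≤ length (xs ++ ys)
  2≤length-++ {ys = ys} xs≢[] ys≢[] = ≤-<-trans (length-pos ys≢[]) (length-proper-suffix-< ys xs≢[])

  ++-nonemptyˡ : ∀ {xs} (ys : List A) → xs ≢ [] → xs ++ ys ≢ []
  ++-nonemptyˡ ys xs≢[] = xs≢[] ∘ ++-conicalˡ _ ys

  ++-nonemptyʳ : ∀ (xs : List A) {ys} → ys ≢ [] → xs ++ ys ≢ []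
  ++-nonemptyʳ [] ys≢[] = ys≢[]
  ++-nonemptyʳ (x ∷ xs) _ ()

  ∷ʳ-nonempty : ∀ (xs : List A) {x} → xs ∷ʳ x ≢ []
  ∷ʳ-nonempty xs = ++-nonemptyʳ xs λ ()

  ++-levi : ∀ (a b c d : List A) → a ++ b ≡ c ++ d →
            (∃ λ e → c ≡ a ++ e × b ≡ e ++ d) ⊎ (∃ λ e → a ≡ c ++ e × d ≡ e ++ b)
  ++-levi [] b c d eq = inj₁ (c , refl , eq)
  ++-levi (x ∷ a) b [] d eq = inj₂ (x ∷ a , refl , sym eq)
  ++-levi (x ∷ a) b (y ∷ c) d eq with ∷-injective eq
  ... | refl , eq′ with ++-levi a b c d eq′
  ...   | inj₁ (e , c≡ , b≡) = inj₁ (e , cong (x ∷_) c≡ , b≡)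
  ...   | inj₂ (e , a≡ , d≡) = inj₂ (e , cong (x ∷_) a≡ , d≡)

  ++-length-≤⇒[] : ∀ (e d : List A) → length (e ++ d) ≤ length d → e ≡ []
  ++-length-≤⇒[] [] d _ = refl
  ++-length-≤⇒[] (x ∷ e) d le = contradiction (s≤s (length-suffix-≤ e d)) (≤⇒≯ le)

  ++-suffix-of-longer : ∀ (a b c d : List A) → a ++ b ≡ c ++ d → length b ≤ length d →
                   ∃ λ e → d ≡ e ++ b × a ≡ c ++ e
  ++-suffix-of-longer a b c d eq le with ++-levi a b c d eq
  ... | inj₂ (e , a≡ , d≡) = e , d≡ , a≡
  ... | inj₁ (e , c≡ , b≡) with ++-length-≤⇒[] e d (subst (λ v → length v ≤ _) b≡ le)
  ...   | refl = [] , sym b≡ , trans (trans (sym (++-identityʳ a)) (sym c≡)) (sym (++-identityʳ c))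

  ++-cancel-equal-length : ∀ (a b c d : List A) → a ++ b ≡ c ++ d → length b ≡ length d → b ≡ d × a ≡ c
  ++-cancel-equal-length a b c d eq len with ++-suffix-of-longer a b c d eq (subst (length b ≤_) len ≤-refl)
  ... | e , d≡ , a≡ with ++-length-≤⇒[] e b (subst (_≤ length b) (trans len (cong length d≡)) ≤-refl)
  ...   | refl = sym d≡ , trans a≡ (++-identityʳ c)

  concat-∷ʳ : ∀ (xss : List (List A)) xs → concat (xss ∷ʳ xs) ≡ concat xss ++ xs
  concat-∷ʳ xss xs = begin
    concat (xss ++ [ xs ])      ≡⟨ concat-++ xss [ xs ] ⟨
    concat xss ++ (xs ++ [])    ≡⟨ cong (concat xss ++_) (++-identityʳ xs) ⟩
    concat xss ++ xs            ∎

  AllPairs-++⁻ˡ : ∀ {ℓ} {R : Rel A ℓ} xs {ys} → AllPairs R (xs ++ ys) → AllPairs R xs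
  AllPairs-++⁻ˡ [] _ = []
  AllPairs-++⁻ˡ (x ∷ xs) (Rx ∷ Rxs) = All.++⁻ˡ xs Rx ∷ AllPairs-++⁻ˡ xs Rxs

  AllPairs-∷ʳ⇒All-last : ∀ {ℓ} {R : Rel A ℓ} {xs x} → R x x → AllPairs R (xs ∷ʳ x) → All (λ y → R y x) (xs ∷ʳ x)
  AllPairs-∷ʳ⇒All-last {xs = []} Rxx _ = Rxx ∷ []
  AllPairs-∷ʳ⇒All-last {xs = y ∷ xs} Rxx (Ry ∷ Rxs) = proj₂ (All.∷ʳ⁻ Ry) ∷ AllPairs-∷ʳ⇒All-last Rxx Rxs

  concat-concat-replicate : ∀ k (xss : List (List A)) →
                            concat (concat (replicate k xss)) ≡ concat (replicate k (concat xss))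
  concat-concat-replicate k xss = begin
    concat (concat (replicate k xss))        ≡⟨ concat-concat (replicate k xss) ⟨
    concat (map concat (replicate k xss))    ≡⟨ cong concat (map-replicate concat k xss) ⟩
    concat (replicate k (concat xss))        ∎

module _ {m : ℕ} where

  private
    W = Word m

  open RawMonad (¬¬-Monad {a = 0ℓ})

  infix 4 _<ˡ_ _≤ˡ_

  _<ˡ_ : Rel W _
  _<ˡ_ = Lex-< _≡_ _<ᶠ_

  _≤ˡ_ : Rel W _
  u ≤ˡ v = u ≡ v ⊎ u <ˡ v

  <ˡ-irrefl : ∀ {u} → ¬ u <ˡ u
  <ˡ-irrefl = Lex.<-irreflexive Fin.<-irrefl (Pointwise.refl refl)

  <ˡ-trans : ∀ {u v w} → u <ˡ v → v <ˡ w → u <ˡ w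
  <ˡ-trans = Lex.<-transitive isEquivalence (resp₂ _<ᶠ_) Fin.<-trans

  _<ˡ?_ : ∀ u v → Dec (u <ˡ v)
  _<ˡ?_ = Lex.<-decidable Fin._≟_ Fin._<?_

  ≤ˡ-or->ˡ : ∀ u v → u ≤ˡ v ⊎ v <ˡ u
  ≤ˡ-or->ˡ u v with Lex.<-compare sym Fin.<-cmp u v
  ... | tri< u<v _ _ = inj₁ (inj₂ u<v)
  ... | tri≈ _ u≋v _ = inj₁ (inj₁ (Pointwise-≡⇒≡ u≋v))
  ... | tri> _ _ v<u = inj₂ v<u

  ≤ˡ-<ˡ-trans : ∀ {u v w} → u ≤ˡ v → v <ˡ w → u <ˡ w
  ≤ˡ-<ˡ-trans (inj₁ refl) v<w = v<w
  ≤ˡ-<ˡ-trans (inj₂ u<v) v<w = <ˡ-trans u<v v<w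

  <ˡ-≤ˡ-trans : ∀ {u v w} → u <ˡ v → v ≤ˡ w → u <ˡ w
  <ˡ-≤ˡ-trans u<v (inj₁ refl) = u<v
  <ˡ-≤ˡ-trans u<v (inj₂ v<w) = <ˡ-trans u<v v<w

  ≤ˡ-trans : ∀ {u v w} → u ≤ˡ v → v ≤ˡ w → u ≤ˡ w
  ≤ˡ-trans (inj₁ refl) v≤w = v≤w
  ≤ˡ-trans (inj₂ u<v) v≤w = inj₂ (<ˡ-≤ˡ-trans u<v v≤w)

  ≤ˡ⇒≯ˡ : ∀ {u v} → u ≤ˡ v → ¬ v <ˡ u
  ≤ˡ⇒≯ˡ u≤v v<u = <ˡ-irrefl (≤ˡ-<ˡ-trans u≤v v<u)

  <ˡ-++ʳ : ∀ {u v} (z : W) → u <ˡ v → u <ˡ v ++ z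
  <ˡ-++ʳ z halt = halt
  <ˡ-++ʳ z (this x<y) = this x<y
  <ˡ-++ʳ z (next refl u<v) = next refl (<ˡ-++ʳ z u<v)

  <ˡ-proper-prefix : ∀ u {s} → s ≢ [] → u <ˡ u ++ s
  <ˡ-proper-prefix [] {[]} s≢[] = ⊥-elim (s≢[] refl)
  <ˡ-proper-prefix [] {_ ∷ _} _ = halt
  <ˡ-proper-prefix (x ∷ u) s≢[] = next refl (<ˡ-proper-prefix u s≢[])

  ≤ˡ-prefix : ∀ u s → u ≤ˡ u ++ s
  ≤ˡ-prefix u [] = inj₁ (sym (++-identityʳ u))
  ≤ˡ-prefix u (x ∷ s) = inj₂ (<ˡ-proper-prefix u λ ())

  <ˡ⇒<lex : ∀ {u v} → u <ˡ v → u <lex v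
  <ˡ⇒<lex {v = y ∷ ys} halt = inj₁ (y ∷ ys , (λ ()) , refl)
  <ˡ⇒<lex (this {x} {xs} {y} {ys} x<y) = inj₂ ([] , x , y , xs , ys , x<y , refl , refl)
  <ˡ⇒<lex (next {x} refl u<v) with <ˡ⇒<lex u<v
  ... | inj₁ (s , s≢[] , v≡) = inj₁ (s , s≢[] , cong (x ∷_) v≡)
  ... | inj₂ (p , i , j , s , t , i<j , u≡ , v≡) =
    inj₂ (x ∷ p , i , j , s , t , i<j , cong (x ∷_) u≡ , cong (x ∷_) v≡)

  <lex⇒<ˡ : ∀ {u v} → u <lex v → u <ˡ v
  <lex⇒<ˡ {u} (inj₁ (s , s≢[] , refl)) = <ˡ-proper-prefix u s≢[]
  <lex⇒<ˡ (inj₂ (p , i , j , s , t , i<j , refl , refl)) = common-prefix p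
    where
    common-prefix : ∀ p → p ++ i ∷ s <ˡ p ++ j ∷ t
    common-prefix [] = this i<j
    common-prefix (x ∷ p) = next refl (common-prefix p)

  ≤ˡ⇒≤lex : ∀ {u v} → u ≤ˡ v → u ≤lex v
  ≤ˡ⇒≤lex (inj₁ u≡v) = inj₁ u≡v
  ≤ˡ⇒≤lex (inj₂ u<v) = inj₂ (<ˡ⇒<lex u<v)

  ≤lex⇒≤ˡ : ∀ {u v} → u ≤lex v → u ≤ˡ v
  ≤lex⇒≤ˡ (inj₁ u≡v) = inj₁ u≡v
  ≤lex⇒≤ˡ (inj₂ u<v) = inj₂ (<lex⇒<ˡ u<v)

  Sorted : List W → Set
  Sorted = AllPairs _≤ˡ_

  IsFactorization : W → List W → Set
  IsFactorization w fs = concat fs ≡ w × All Nyldon fs × Sorted fs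

  factor-length-≤ : ∀ (fs : List W) → All (λ f → length f ≤ length (concat fs)) fs
  factor-length-≤ [] = []
  factor-length-≤ (f ∷ fs) =
    length-prefix-≤ f _ ∷ All.map (λ le → ≤-trans le (length-suffix-≤ f _)) (factor-length-≤ fs)

  factor-length-< : ∀ {fs : List W} {w} → concat fs ≡ w → All (_≢ []) fs → 2 ≤ length fs →
                    All (λ f → length f < length w) fs
  factor-length-< {f ∷ g ∷ fs} refl (f≢[] ∷ g≢[] ∷ _) _ =
    length-proper-prefix-< f (++-nonemptyˡ (concat fs) g≢[]) ∷
    All.map (λ le → ≤-<-trans le (length-proper-suffix-< _ f≢[])) (factor-length-≤ (g ∷ fs))
  factor-length-< {_ ∷ []} _ _ (s≤s ())

  NyldonF-nonempty : ∀ n {w : W} → NyldonF n w → w ≢ []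
  NyldonF-nonempty (suc n) {[]} (inj₂ (w≢[] , _)) = w≢[]
  NyldonF-nonempty (suc n) {_ ∷ _} _ ()

  NyldonF-fuel : ∀ {n n′} {w : W} → length w ≤ n → length w ≤ n′ → NyldonF n w → NyldonF n′ w
  NyldonF-fuel {suc n} {zero} {[]} _ _ Nw = ⊥-elim (NyldonF-nonempty (suc n) Nw refl)
  NyldonF-fuel {suc n} {suc n′} _ _ (inj₁ len≡1) = inj₁ len≡1
  NyldonF-fuel {suc n} {suc n′} w≤n w≤n′ (inj₂ (w≢[] , irreducible)) =
    inj₂ (w≢[] , λ (fs , two , cat , Nfs , linked) → irreducible (fs , two , cat ,
      All.zipWith (λ (f< , Nf) → NyldonF-fuel (≤-pred (≤-trans f< w≤n′)) (≤-pred (≤-trans f< w≤n)) Nf)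
        (factor-length-< cat (All.map (NyldonF-nonempty n′) Nfs) two , Nfs) , linked))

  nyldon-nonempty : ∀ {w : W} → Nyldon w → w ≢ []
  nyldon-nonempty = NyldonF-nonempty _

  nyldon-irreducible : ∀ {w fs} → Nyldon w → IsFactorization w fs → ¬ 2 ≤ length fs
  nyldon-irreducible {_ ∷ _} {f ∷ fs} Nw (cat , Nfs@(Nf ∷ _) , sorted) two
    with Nw | factor-length-< cat (All.map nyldon-nonempty Nfs) two
  ... | inj₁ len≡1 | f< ∷ _ = ≤⇒≯ (length-pos (nyldon-nonempty Nf)) (subst (length f <_) len≡1 f<)
  ... | inj₂ (_ , irreducible) | shorter = irreducible (f ∷ fs , two , cat ,
        All.zipWith (λ (f< , Nf) → NyldonF-fuel ≤-refl (≤-pred f<) Nf) (shorter , Nfs) ,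
        Linked.map ≤ˡ⇒≤lex (AllPairs⇒Linked sorted))

  nyldon-intro : ∀ {w} → w ≢ [] → (∀ {fs} → IsFactorization w fs → ¬ 2 ≤ length fs) → Nyldon w
  nyldon-intro {[]} w≢[] _ = ⊥-elim (w≢[] refl)
  nyldon-intro {_ ∷ _} _ irreducible = inj₂ ((λ ()) , λ (fs , two , cat , Nfs , linked) →
    irreducible (cat ,
      All.zipWith (λ (f< , Nf) → NyldonF-fuel (≤-pred f<) ≤-refl Nf)
        (factor-length-< cat (All.map (NyldonF-nonempty _) Nfs) two , Nfs) ,
      Linked⇒AllPairs ≤ˡ-trans (Linked.map ≤lex⇒≤ˡ linked)) two)

  factorization-++ : ∀ {u v hs h ts} → IsFactorization u (hs ∷ʳ h) → IsFactorization v ts → All (h ≤ˡ_) ts →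
                     IsFactorization (u ++ v) ((hs ∷ʳ h) ++ ts)
  factorization-++ {hs = hs} {h} {ts} (refl , Nhs , sortedH) (refl , Nts , sortedT) h≤ts =
    sym (concat-++ (hs ∷ʳ h) ts) , All.++⁺ Nhs Nts ,
    AllPairs.++⁺ sortedH sortedT
      (All.map (λ x≤h → All.map (≤ˡ-trans x≤h) h≤ts) (AllPairs-∷ʳ⇒All-last (inj₁ refl) sortedH))

  nyldon-factorization : ∀ {w} → Nyldon w → IsFactorization w [ w ]
  nyldon-factorization {w} Nw = ++-identityʳ w , Nw ∷ [] , [] ∷ []

  ++-last-factor : ∀ {y hs h} → IsFactorization y (hs ∷ʳ h) → ∀ x → x ++ y ≡ (x ++ concat hs) ++ h
  ++-last-factor {hs = hs} {h} (refl , _) x = begin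
    x ++ concat (hs ∷ʳ h)    ≡⟨ cong (x ++_) (concat-∷ʳ hs h) ⟩
    x ++ (concat hs ++ h)    ≡⟨ ++-assoc x (concat hs) h ⟨
    (x ++ concat hs) ++ h    ∎

  nyldon-stable : ∀ {w : W} → Stable (Nyldon w)
  nyldon-stable ¬¬Nw = nyldon-intro
    (λ w≡[] → ¬¬Nw λ Nw → nyldon-nonempty Nw w≡[])
    (λ F two → ¬¬Nw λ Nw → nyldon-irreducible Nw F two)

  nyldon-factorization-singleton : ∀ {w fs} → Nyldon w → IsFactorization w fs → fs ≡ [ w ]
  nyldon-factorization-singleton {fs = []} Nw (refl , _) = ⊥-elim (nyldon-nonempty Nw refl)
  nyldon-factorization-singleton {fs = f ∷ []} Nw (refl , _) = cong [_] (sym (++-identityʳ f))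
  nyldon-factorization-singleton {fs = _ ∷ _ ∷ _} Nw F = ⊥-elim (nyldon-irreducible Nw F (s≤s (s≤s z≤n)))

  factorization-exists : ∀ {w} → w ≢ [] → ¬ ¬ ∃₂ λ f fs → IsFactorization w (f ∷ fs)
  -- Were there no factorization, w would be Nyldon, and [ w ] would be one.
  factorization-exists {w} w≢[] noFactorization =
    noFactorization (w , [] , nyldon-factorization Nw)
    where
    Nw : Nyldon w
    Nw = nyldon-intro w≢[] irreducible
      where
      irreducible : ∀ {fs} → IsFactorization w fs → ¬ 2 ≤ length fs
      irreducible {f ∷ fs} F _ = noFactorization (f , fs , F)

  factorization-exists-∷ʳ : ∀ {w} → w ≢ [] → ¬ ¬ ∃₂ λ fs f → IsFactorization w (fs ∷ʳ f)
  factorization-exists-∷ʳ {w} w≢[] noFactorization =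
    factorization-exists w≢[] λ (f , fs , F) → from-initLast (initLast (f ∷ fs)) F
    where
    from-initLast : ∀ {gs} → InitLast gs → IsFactorization w gs → ⊥
    from-initLast [] (w≡[] , _) = w≢[] (sym w≡[])
    from-initLast (gs ∷ʳ′ g) F = noFactorization (gs , g , F)

  ProperNyldonSuffix : W → W → Set
  ProperNyldonSuffix s w = Nyldon s × ∃ λ z → z ≢ [] × w ≡ z ++ s

  LongestProperNyldonSuffix : W → W → Set
  LongestProperNyldonSuffix s w =
    ProperNyldonSuffix s w × (∀ {s′} → ProperNyldonSuffix s′ w → length s′ ≤ length s)

  proper-suffix-of-∷ : ∀ {x u s′} → ProperNyldonSuffix s′ (x ∷ u) → s′ ≡ u ⊎ ProperNyldonSuffix s′ u
  proper-suffix-of-∷ (_ , [] , []≢[] , _) = ⊥-elim ([]≢[] refl)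
  proper-suffix-of-∷ (_ , _ ∷ [] , _ , refl) = inj₁ refl
  proper-suffix-of-∷ (Ns′ , _ ∷ y ∷ z , _ , refl) = inj₂ (Ns′ , y ∷ z , (λ ()) , refl)

  nyldon-longest-proper-suffix-∷ : ∀ {x u} → Nyldon u → LongestProperNyldonSuffix u (x ∷ u)
  nyldon-longest-proper-suffix-∷ {x} Nu = (Nu , [ x ] , (λ ()) , refl) , λ s′ →
    case proper-suffix-of-∷ s′ of λ where
      (inj₁ refl) → ≤-refl
      (inj₂ (_ , z , _ , refl)) → length-suffix-≤ z _

  longest-proper-nyldon-suffix-∷ : ∀ {x u s} → ¬ Nyldon u → LongestProperNyldonSuffix s u →
                                   LongestProperNyldonSuffix s (x ∷ u)
  longest-proper-nyldon-suffix-∷ {x} ¬Nu ((Ns , z , _ , u≡) , longest) =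
    (Ns , x ∷ z , (λ ()) , cong (x ∷_) u≡) , λ s′ →
    case proper-suffix-of-∷ s′ of λ where
      (inj₁ refl) → ⊥-elim (¬Nu (proj₁ s′))
      (inj₂ s′-of-u) → longest s′-of-u

  longest-proper-nyldon-suffix-exists : ∀ {w} → 2 ≤ length w → ¬ ¬ ∃ λ s → LongestProperNyldonSuffix s w
  longest-proper-nyldon-suffix-exists {_ ∷ []} (s≤s ())
  longest-proper-nyldon-suffix-exists {x ∷ y ∷ u} _ = exists x y u
    where
    exists : ∀ x y (u : W) → ¬ ¬ ∃ λ s → LongestProperNyldonSuffix s (x ∷ y ∷ u)
    exists x y [] = return (_ , nyldon-longest-proper-suffix-∷ (inj₁ refl))
    exists x y (z ∷ u) = ¬¬-excluded-middle >>= λ where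
      (yes Nyzu) → return (_ , nyldon-longest-proper-suffix-∷ Nyzu)
      (no ¬Nyzu) → Product.map₂ (longest-proper-nyldon-suffix-∷ ¬Nyzu) <$> exists y z u

  proper-suffix-shorter : ∀ {s w} → ProperNyldonSuffix s w → length s < length w
  proper-suffix-shorter {s} (_ , z , z≢[] , refl) = length-proper-suffix-< s z≢[]

  proper-suffix⇒2≤length : ∀ {s w} → ProperNyldonSuffix s w → 2 ≤ length w
  proper-suffix⇒2≤length (Ns , z , z≢[] , refl) = 2≤length-++ z≢[] (nyldon-nonempty Ns)

  SuffixesSmaller : W → Set
  SuffixesSmaller w = ∀ {s} → ProperNyldonSuffix s w → s <ˡ w

  LastFactorLongest : W → Set
  LastFactorLongest w = ∀ {fs f z s} → IsFactorization w (fs ∷ʳ f) → w ≡ z ++ s → Nyldon s → length s ≤ length f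

  suffix-factorization-below : ∀ {g z y} → Nyldon g → SuffixesSmaller g → g ≡ z ++ y → y ≢ [] →
                               ¬ ¬ ∃₂ λ hs h → IsFactorization y (hs ∷ʳ h) × h ≤ˡ g
  suffix-factorization-below {z = []} Ng _ refl _ = return ([] , _ , nyldon-factorization Ng , inj₁ refl)
  suffix-factorization-below {z = c ∷ z} Ng smaller g≡ y≢[] = do
    (hs , h , Y@(_ , Nhs , _)) ← factorization-exists-∷ʳ y≢[]
    let g≡′ = trans g≡ (++-last-factor Y (c ∷ z))
    return (hs , h , Y , inj₂ (smaller (proj₂ (All.∷ʳ⁻ Nhs) , _ , (λ ()) , g≡′)))

  last-factor-longest-step : ∀ {w fs f z s} → All SuffixesSmaller fs → IsFactorization w (fs ∷ʳ f) →
                             w ≡ z ++ s → Nyldon s → length s ≤ length f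
  last-factor-longest-step {fs = []} {f} {z} {s} _ (refl , _) w≡ _ =
    subst (λ v → length s ≤ length v) (trans (sym w≡) (++-identityʳ f)) (length-suffix-≤ z s)
  last-factor-longest-step {fs = g ∷ fs} {f} {z} {s} (smaller ∷ smallers) (refl , Ng ∷ Nfs , g≤fs ∷ sorted) w≡ Ns
    with ++-levi g (concat (fs ∷ʳ f)) z s w≡
  ... | inj₁ (_ , _ , rest≡) = last-factor-longest-step smallers (refl , Nfs , sorted) rest≡ Ns
  ... | inj₂ ([] , _ , s≡rest) = last-factor-longest-step smallers (refl , Nfs , sorted) (sym s≡rest) Ns
  ... | inj₂ (_ ∷ _ , g≡ , s≡) = ⊥-elim (suffix-factorization-below Ng smaller g≡ (λ ()) λ (hs , h , E , h≤g) →
        nyldon-irreducible Ns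
          (subst (λ v → IsFactorization v ((hs ∷ʳ h) ++ (fs ∷ʳ f))) (sym s≡)
            (factorization-++ E (refl , Nfs , sorted) (All.map (≤ˡ-trans h≤g) g≤fs)))
          (2≤length-++ (∷ʳ-nonempty hs) (∷ʳ-nonempty fs)))

  -- By maximality of g″, every factorization of e g″ ends in g″; the remaining factors form a
  -- factorization of e, which is therefore [ e ], and sortedness gives e ≤ g″.
  no-larger-nyldon-before-longest-suffix : ∀ {g g″ p e} → LastFactorLongest (e ++ g″) →
    LongestProperNyldonSuffix g″ g → Nyldon e → g″ <ˡ e → g ≡ p ++ (e ++ g″) → p ≢ [] → ⊥
  no-larger-nyldon-before-longest-suffix {g″ = g″} {p} {e} lastLongest ((Ng″ , _) , longest) Ne g″<e g≡ p≢[] =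
    factorization-exists-∷ʳ (++-nonemptyˡ g″ (nyldon-nonempty Ne)) λ (ss , t , S) → contradict S
    where
    contradict : ∀ {ss t} → IsFactorization (e ++ g″) (ss ∷ʳ t) → ⊥
    contradict {ss} {t} S@(cat , Nss , sortedS) with All.∷ʳ⁻ Nss
    ... | Nss′ , Nt with ++-cancel-equal-length (concat ss) t e g″ (trans (sym (concat-∷ʳ ss t)) cat)
                           (≤-antisym (longest (Nt , _ , ++-nonemptyˡ _ p≢[] , trans g≡ (++-last-factor S p)))
                                      (lastLongest S refl Ng″))
    ...   | refl , ss≡e with nyldon-factorization-singleton Ne (ss≡e , Nss′ , AllPairs-++⁻ˡ ss sortedS)
    ...     | refl with sortedS
    ...       | (e≤g″ ∷ []) ∷ _ = ≤ˡ⇒≯ˡ e≤g″ g″<e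

  standard-factorization-step : ∀ {g z g″} → (∀ {u} → length u < length g → LastFactorLongest u) → Nyldon g →
                                LongestProperNyldonSuffix g″ g → g ≡ z ++ g″ → Nyldon z × g″ <ˡ z
  standard-factorization-step {g} {z} {g″} shorter Ng lpns@((Ng″ , z₀ , z₀≢[] , g≡z₀g″) , _) g≡ =
    nyldon-stable (proj₁ <$> split) , decidable-stable (g″ <ˡ? z) (proj₂ <$> split)
    where
    z≢[] : z ≢ []
    z≢[] = z₀≢[] ∘ trans (++-cancelʳ g″ z₀ z (trans (sym g≡z₀g″) g≡))

    larger-last-factor : ∀ es {e} → IsFactorization z (es ∷ʳ e) → g″ <ˡ e → Nyldon z × g″ <ˡ z
    larger-last-factor [] {e} (cat , Ne ∷ [] , _) g″<e =
      subst (λ v → Nyldon v × g″ <ˡ v) (trans (sym (++-identityʳ e)) cat) (Ne , g″<e)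
    larger-last-factor (p ∷ ps) {e} (cat , Np ∷ Nes , _) g″<e =
      ⊥-elim (no-larger-nyldon-before-longest-suffix (shorter e++g″<g) lpns (proj₂ (All.∷ʳ⁻ Nes)) g″<e g≡′ P≢[])
      where
      P≢[] : concat (p ∷ ps) ≢ []
      P≢[] = ++-nonemptyˡ _ (nyldon-nonempty Np)
      g≡′ : g ≡ concat (p ∷ ps) ++ (e ++ g″)
      g≡′ = begin
        g                                ≡⟨ g≡ ⟩
        z ++ g″                          ≡⟨ cong (_++ g″) (trans (sym cat) (concat-∷ʳ (p ∷ ps) e)) ⟩
        (concat (p ∷ ps) ++ e) ++ g″     ≡⟨ ++-assoc (concat (p ∷ ps)) e g″ ⟩
        concat (p ∷ ps) ++ (e ++ g″)     ∎
      e++g″<g : length (e ++ g″) < length g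
      e++g″<g = subst (λ v → length (e ++ g″) < length v) (sym g≡′) (length-proper-suffix-< (e ++ g″) P≢[])

    from-last-factor : ∀ {es e} → IsFactorization z (es ∷ʳ e) → Nyldon z × g″ <ˡ z
    from-last-factor {es} {e} Z with ≤ˡ-or->ˡ e g″
    ... | inj₂ g″<e = larger-last-factor es Z g″<e
    ... | inj₁ e≤g″ = ⊥-elim (nyldon-irreducible Ng
          (subst (λ v → IsFactorization v ((es ∷ʳ e) ∷ʳ g″)) (sym g≡)
            (factorization-++ Z (nyldon-factorization Ng″) (e≤g″ ∷ [])))
          (2≤length-++ (∷ʳ-nonempty es) λ ()))

    split : ¬ ¬ (Nyldon z × g″ <ˡ z)
    split = (λ (_ , _ , Z) → from-last-factor Z) <$> factorization-exists-∷ʳ z≢[]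

  proper-suffix-≤ˡ-longest : ∀ {g g″ h} → SuffixesSmaller g″ → LongestProperNyldonSuffix g″ g →
                             ProperNyldonSuffix h g → h ≤ˡ g″
  proper-suffix-≤ˡ-longest smaller ((_ , z₀ , _ , g≡z₀g″) , longest) h-suffix@(Nh , z , _ , g≡zh)
    with ++-suffix-of-longer z _ z₀ _ (trans (sym g≡zh) g≡z₀g″) (longest h-suffix)
  ... | [] , refl , _ = inj₁ refl
  ... | e@(_ ∷ _) , g″≡ , _ = inj₂ (smaller (Nh , e , (λ ()) , g″≡))

  suffixes-smaller-step : ∀ {g} → (∀ {u} → length u < length g → LastFactorLongest u) →
                          (∀ {u} → length u < length g → Nyldon u → SuffixesSmaller u) →
                          Nyldon g → SuffixesSmaller g
  suffixes-smaller-step {g} shorterLast shorterSmaller Ng {h} h-suffix = decidable-stable (h <ˡ? g) do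
    (g″ , lpns@(g″-suffix@(Ng″ , z , _ , g≡) , _)) ←
      longest-proper-nyldon-suffix-exists (proper-suffix⇒2≤length h-suffix)
    let h≤g″ = proper-suffix-≤ˡ-longest (shorterSmaller (proper-suffix-shorter g″-suffix) Ng″) lpns h-suffix
        g″<z = proj₂ (standard-factorization-step shorterLast Ng lpns g≡)
    return (subst (h <ˡ_) (sym g≡) (<ˡ-++ʳ g″ (≤ˡ-<ˡ-trans h≤g″ g″<z)))

  init-factors-shorter : ∀ {w fs f} → IsFactorization w (fs ∷ʳ f) → All (λ g → length g < length w) fs
  init-factors-shorter {fs = []} _ = []
  init-factors-shorter {fs = g ∷ fs} (cat , Nfs , _) = All.++⁻ˡ (g ∷ fs)
    (factor-length-< cat (All.map nyldon-nonempty Nfs) (s≤s (length-pos (∷ʳ-nonempty fs))))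

  _⊏_ : Rel W _
  _⊏_ = _<_ on length

  ⊏-wellFounded : WellFounded _⊏_
  ⊏-wellFounded = On.wellFounded length <-wellFounded

  suffix-facts : ∀ {w} → Acc _⊏_ w → LastFactorLongest w × (Nyldon w → SuffixesSmaller w)
  suffix-facts (acc rec) =
    (λ F@(_ , Nfs , _) → last-factor-longest-step
       (All.zipWith (λ (g< , Ng) {_} → proj₂ (suffix-facts (rec g<)) Ng) (init-factors-shorter F , proj₁ (All.∷ʳ⁻ Nfs))) F) ,
    suffixes-smaller-step (λ u< → proj₁ (suffix-facts (rec u<))) (λ u< → proj₂ (suffix-facts (rec u<)))

  last-factor-longest : ∀ {w} → LastFactorLongest w
  last-factor-longest {w} = proj₁ (suffix-facts (⊏-wellFounded w))

  suffixes-smaller : ∀ {w} → Nyldon w → SuffixesSmaller w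
  suffixes-smaller {w} = proj₂ (suffix-facts (⊏-wellFounded w))

  standard-factorization : ∀ {g z g″} → Nyldon g → LongestProperNyldonSuffix g″ g → g ≡ z ++ g″ → Nyldon z × g″ <ˡ z
  standard-factorization = standard-factorization-step (λ _ → last-factor-longest)

  Mergeable : W → W → Set
  Mergeable g x = length g ≡ 1 ⊎ ∃ λ g″ → LongestProperNyldonSuffix g″ g × g″ ≤ˡ x

  mergeable-suffix-not-nyldon : ∀ {g x z y} → Nyldon x → Mergeable g x → g ≡ z ++ y → z ≢ [] → y ≢ [] →
                                ¬ Nyldon (y ++ x)
  mergeable-suffix-not-nyldon _ (inj₁ len≡1) g≡ z≢[] y≢[] _
    with subst (2 ≤_) len≡1 (subst (λ v → 2 ≤ length v) (sym g≡) (2≤length-++ z≢[] y≢[]))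
  ... | s≤s ()
  mergeable-suffix-not-nyldon {z = z} Nx (inj₂ (g″ , lpns@((Ng″ , _) , _) , g″≤x)) g≡ z≢[] y≢[] Nyx =
    factorization-exists-∷ʳ y≢[] λ (hs , h , Y@(_ , Nhs , _)) →
      let h-suffix = proj₂ (All.∷ʳ⁻ Nhs) , z ++ concat hs , ++-nonemptyˡ _ z≢[] , trans g≡ (++-last-factor Y z)
          h≤g″ = proper-suffix-≤ˡ-longest (suffixes-smaller Ng″) lpns h-suffix
      in nyldon-irreducible Nyx (factorization-++ Y (nyldon-factorization Nx) (≤ˡ-trans h≤g″ g″≤x ∷ []))
           (2≤length-++ (∷ʳ-nonempty hs) λ ())

  merge : ∀ {g x} → Nyldon g → Nyldon x → x <ˡ g → Mergeable g x →
          Nyldon (g ++ x) × LongestProperNyldonSuffix x (g ++ x)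
  merge {g} {x} Ng Nx x<g mergeable =
    nyldon-intro (++-nonemptyˡ x g≢[]) irreducible , (Nx , g , g≢[] , refl) , longest
    where
    g≢[] : g ≢ []
    g≢[] = nyldon-nonempty Ng

    longest : ∀ {s} → ProperNyldonSuffix s (g ++ x) → length s ≤ length x
    longest {s} (Ns , z , z≢[] , eq) with ≤-total (length s) (length x)
    ... | inj₁ s≤x = s≤x
    ... | inj₂ x≤s with ++-suffix-of-longer g x z s eq x≤s
    ...   | [] , refl , _ = ≤-refl
    ...   | _ ∷ _ , s≡ , g≡ = ⊥-elim (mergeable-suffix-not-nyldon Nx mergeable g≡ z≢[] (λ ()) (subst Nyldon s≡ Ns))

    irreducible-∷ʳ : ∀ ls {l} → IsFactorization (g ++ x) (ls ∷ʳ l) → ¬ 2 ≤ length (ls ∷ʳ l)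
    irreducible-∷ʳ [] _ (s≤s ())
    irreducible-∷ʳ ls@(p ∷ ps) {l} F@(cat , Np ∷ Nls , sorted) _
      with ++-suffix-of-longer g x (concat ls) l (trans (sym cat) (concat-∷ʳ ls l)) (last-factor-longest {fs = ls} F refl Nx)
    ... | _ ∷ _ , l≡ , g≡ = mergeable-suffix-not-nyldon Nx mergeable g≡ (++-nonemptyˡ _ (nyldon-nonempty Np)) (λ ())
          (subst Nyldon l≡ (proj₂ (All.∷ʳ⁻ Nls)))
    ... | [] , refl , g≡ with nyldon-factorization-singleton Ng
                                (trans (sym (++-identityʳ _)) (sym g≡) , Np ∷ proj₁ (All.∷ʳ⁻ Nls) , AllPairs-++⁻ˡ ls sorted)
    ...   | refl with sorted
    ...     | (g≤x ∷ []) ∷ _ = ≤ˡ⇒≯ˡ g≤x x<g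

    irreducible : ∀ {fs} → IsFactorization (g ++ x) fs → ¬ 2 ≤ length fs
    irreducible {fs} F two with initLast fs
    ... | ls ∷ʳ′ l = irreducible-∷ʳ ls F two

  FactorizationAbove : W → W → Set
  FactorizationAbove h w = ∃₂ λ r rs → IsFactorization w (r ∷ rs) × h ≤ˡ r

  above-weaken : ∀ {h h′ w} → h ≤ˡ h′ → FactorizationAbove h′ w → FactorizationAbove h w
  above-weaken h≤h′ (r , rs , F , h′≤r) = r , rs , F , ≤ˡ-trans h≤h′ h′≤r

  cons-factorization : ∀ {g w t ts} → Nyldon g → IsFactorization w (t ∷ ts) → g ≤ˡ t →
                       IsFactorization (g ++ w) (g ∷ t ∷ ts)
  cons-factorization Ng (refl , Nts , sorted@(t≤ts ∷ _)) g≤t =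
    refl , Ng ∷ Nts , (g≤t ∷ All.map (≤ˡ-trans g≤t) t≤ts) ∷ sorted

  insert-mergeable : ∀ {g w t ts} → Nyldon g → IsFactorization w (t ∷ ts) → Mergeable g t →
                     FactorizationAbove g (g ++ w)
  insert-mergeable {g} {t = t} {ts} Ng F@(refl , Nt ∷ Nts , t≤ts ∷ sorted) mergeable with ≤ˡ-or->ˡ g t
  ... | inj₁ g≤t = g , t ∷ ts , cons-factorization Ng F g≤t , inj₁ refl
  ... | inj₂ t<g = above-weaken (≤ˡ-prefix g t)
        (subst (FactorizationAbove (g ++ t)) (++-assoc g t (concat ts))
          (insert-rest ts Nts sorted t≤ts (merge Ng Nt t<g mergeable)))
    where
    insert-rest : ∀ ts → All Nyldon ts → Sorted ts → All (t ≤ˡ_) ts →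
                  Nyldon (g ++ t) × LongestProperNyldonSuffix t (g ++ t) →
                  FactorizationAbove (g ++ t) ((g ++ t) ++ concat ts)
    insert-rest [] _ _ _ (Ngt , _) = g ++ t , [] , (refl , Ngt ∷ [] , [] ∷ []) , inj₁ refl
    insert-rest (t₂ ∷ ts) Nts sorted (t≤t₂ ∷ _) (Ngt , lpns) =
      insert-mergeable Ngt (refl , Nts , sorted) (inj₂ (t , lpns , t≤t₂))

  letter-or-longest-proper-suffix : ∀ {g} → Nyldon g →
                                    ¬ ¬ (length g ≡ 1 ⊎ ∃ λ g″ → LongestProperNyldonSuffix g″ g)
  letter-or-longest-proper-suffix {_ ∷ []} _ = return (inj₁ refl)
  letter-or-longest-proper-suffix {_ ∷ _ ∷ _} _ = inj₂ <$> longest-proper-nyldon-suffix-exists (s≤s (s≤s z≤n))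

  insert : ∀ {g w h t ts} → Acc _⊏_ g → Nyldon g → IsFactorization w (t ∷ ts) → h ≤ˡ g → h ≤ˡ t →
           ¬ ¬ FactorizationAbove h (g ++ w)
  insert {g} {w} {h} {t} {ts} (acc rec) Ng F h≤g h≤t with ≤ˡ-or->ˡ g t
  ... | inj₁ g≤t = return (g , t ∷ ts , cons-factorization Ng F g≤t , h≤g)
  ... | inj₂ t<g = letter-or-longest-proper-suffix Ng >>= λ where
      (inj₁ len≡1) → return (above-weaken h≤g (insert-mergeable Ng F (inj₁ len≡1)))
      (inj₂ (_ , lpns)) → insert-standard lpns
    where
    insert-standard : ∀ {g″} → LongestProperNyldonSuffix g″ g → ¬ ¬ FactorizationAbove h (g ++ w)
    insert-standard {g″} lpns@(g″-suffix@(Ng″ , z , _ , g≡) , _) with standard-factorization Ng lpns g≡ | ≤ˡ-or->ˡ g″ t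
    ... | _ | inj₁ g″≤t = return (above-weaken h≤g (insert-mergeable Ng F (inj₂ (g″ , lpns , g″≤t))))
    ... | Nz , g″<z | inj₂ t<g″ = do
      (_ , _ , R , t≤r) ← insert (rec (proper-suffix-shorter g″-suffix)) Ng″ F (inj₂ t<g″) (inj₁ refl)
      let h≤z = inj₂ (≤ˡ-<ˡ-trans h≤t (<ˡ-trans t<g″ g″<z))
          z<g = subst (λ v → length z < length v) (sym g≡) (length-proper-prefix-< z (nyldon-nonempty Ng″))
          g≡′ = trans (sym (++-assoc z g″ w)) (cong (_++ w) (sym g≡))
      subst (FactorizationAbove h) g≡′ <$> insert (rec z<g) Nz R h≤z (≤ˡ-trans h≤t t≤r)

  insert-all : ∀ {h gs w t ts} → All Nyldon gs → All (h ≤ˡ_) gs → IsFactorization w (t ∷ ts) → h ≤ˡ t →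
               ¬ ¬ FactorizationAbove h (concat gs ++ w)
  insert-all [] [] F h≤t = return (_ , _ , F , h≤t)
  insert-all {gs = g ∷ gs} {w} (Ng ∷ Ngs) (h≤g ∷ h≤gs) F h≤t = do
    (_ , _ , R , h≤r) ← insert-all Ngs h≤gs F h≤t
    subst (FactorizationAbove _) (sym (++-assoc g (concat gs) w)) <$> insert (⊏-wellFounded g) Ng R h≤g h≤r

  minimal-prefix-factor-not-nyldon : ∀ {h gs v} → Nyldon h → All Nyldon gs → All (h ≤ˡ_) gs → Nyldon v → h ≤ˡ v →
                                     ¬ Nyldon (h ++ concat gs ++ v)
  minimal-prefix-factor-not-nyldon Nh Ngs h≤gs Nv h≤v Nw =
    insert-all Ngs h≤gs (nyldon-factorization Nv) h≤v λ (_ , _ , R , h≤r) →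
      nyldon-irreducible Nw (cons-factorization Nh R h≤r) (s≤s (s≤s z≤n))

  ^-suc-regroup : ∀ k h (hs : List W) v →
                  concat (h ∷ hs) ^ suc k ++ v ≡ h ++ concat (hs ++ concat (replicate k (h ∷ hs))) ++ v
  ^-suc-regroup k h hs v = begin
    ((h ++ concat hs) ++ a ^ k) ++ v          ≡⟨ cong (_++ v) (++-assoc h (concat hs) (a ^ k)) ⟩
    (h ++ (concat hs ++ a ^ k)) ++ v          ≡⟨ ++-assoc h _ v ⟩
    h ++ ((concat hs ++ a ^ k) ++ v)          ≡⟨ cong (λ u → h ++ ((concat hs ++ u) ++ v)) (concat-concat-replicate k (h ∷ hs)) ⟨
    h ++ ((concat hs ++ concat X) ++ v)       ≡⟨ cong (λ u → h ++ (u ++ v)) (concat-++ hs X) ⟩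
    h ++ (concat (hs ++ X) ++ v)              ∎
    where
    a = concat (h ∷ hs)
    X = concat (replicate k (h ∷ hs))

lemma4p2 : (m : ℕ) → 1 ≤ m → (a b : Word m) → a ≢ [] → Nyldon (a ++ b) →
           (k : ℕ) → 1 ≤ k → ¬ Nyldon ((a ^ k) ++ (a ++ b))
lemma4p2 m _ a b a≢[] Nab (suc k) _ Nw = factorization-exists a≢[] λ where
  (h , hs , refl , Nh ∷ Nhs , h≤hs ∷ _) →
    minimal-prefix-factor-not-nyldon Nh
      (All.++⁺ Nhs (All.concat⁺ (All.replicate⁺ k (Nh ∷ Nhs))))
      (All.++⁺ h≤hs (All.concat⁺ (All.replicate⁺ k (inj₁ refl ∷ h≤hs))))
      Nab
      (subst (h ≤ˡ_) (sym (++-assoc h (concat hs) b)) (≤ˡ-prefix h (concat hs ++ b)))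
      (subst Nyldon (^-suc-regroup k h hs (a ++ b)) Nw)
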